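{- Let $G$ be a circularly connected bidirected graph, let $\alpha\in\{+,-\}$, and let $s\in V(G)$. Then for every $t\in V(G)$ there exists $\beta\in\{+,-\}$ such that $G$ has an $(\alpha,\beta)$-ditrail from $s$ to $t$.
   Context: All graphs are finite (parallel edges and loops allowed). A bidirected graph is a graph $G$ together with two maps $\sigma^+,\sigma^-$ on $E(G)$ such that for each edge $e$ with ends $u,v$: $\sigma^+(e),\sigma^-(e)\subseteq\{u,v\}$ (one may be empty), $\sigma^+(e)\cup\sigma^-(e)=\{u,v\}$, and if $u\neq v$ then $\sigma^+(e)\cap\sigma^-(e)=\emptyset$. We say $\gamma\in\{+,-\}$ is a sign of $u$ over $e$ if $u\in\sigma^\gamma(e)$. A walk from $u$ to $v$ is a sequence $(s_1,\dots,s_k)$, $k\ge1$ odd, where the odd-indexed terms are vertices with $s_1=u$, $s_k=v$, and each even-indexed term $s_i$ is an edge joining $s_{i-1}$ and $s_{i+1}$; a trail is a walk whose edges are all distinct; it is closed if $s_1=s_k$. A trail $(s_1,\dots,s_k)$ is a ditrail if for every odd $i$ with $1<i<k$ the signs of $s_i$ over $s_{i-1}$ and over $s_{i+1}$ are distinct. For $\alpha,\beta\in\{+,-\}$, an $(\alpha,\beta)$-ditrail is a ditrail with $k>1$ in which the sign of $s_1$ over $s_2$ is $\alpha$ and the sign of $s_k$ over $s_{k-1}$ is $\beta$; in addition, the one-term trail $(s_1)$ ($k=1$) is considered an $(\alpha,\beta)$-ditrail for every $\alpha\neq\beta$. A cyclic ditrail is a closed $(\gamma,-\gamma)$-ditrail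 for some $\gamma\in\{+,-\}$. An edge is circular if some cyclic ditrail contains it. Two vertices are circularly connected if there is a path between them all of whose edges are circular; a bidirected graph is circularly connected if every two of its vertices are circularly connected. -}

module Defs where

open import Data.Nat using (ℕ)
open import Data.Fin using (Fin)
open import Data.Bool using (Bool; true)
open import Data.List using (List; []; _∷_; map)
open import Data.List.Relation.Unary.All using (All)
open import Data.List.Relation.Unary.Unique.Propositional using (Unique)
open import Data.List.Membership.Propositional using (_∈_)
open import Data.Product using (Σ; _×_; _,_; proj₁; proj₂)
open import Data.Sum using (_⊎_)
open import Data.Empty using (⊥)
open import Relation.Binary.PropositionalEquality using (_≡_; _≢_)

data Sign : Set where
  ⊕ ⊖ : Sign

neg : Sign → Sign
neg ⊕ = ⊖
neg ⊖ = ⊕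

-- A finite bidirected graph: vertices Fin nV, edges Fin nE (parallel edges
-- and loops allowed); edge e has ends end₁ e, end₂ e (equal for a loop).
-- σ γ e is the set σ^γ(e) ⊆ V, given by its characteristic function.
record BidirectedGraph : Set where
  field
    nV nE  : ℕ
    end₁   : Fin nE → Fin nV
    end₂   : Fin nE → Fin nV
    σ      : Sign → Fin nE → Fin nV → Bool
    σ-sub  : ∀ γ e x → σ γ e x ≡ true → x ≡ end₁ e ⊎ x ≡ end₂ e
    σ-cover : ∀ e x → x ≡ end₁ e ⊎ x ≡ end₂ e → σ ⊕ e x ≡ true ⊎ σ ⊖ e x ≡ true
    σ-disj : ∀ e → end₁ e ≢ end₂ e → ∀ x → σ ⊕ e x ≡ true → σ ⊖ e x ≡ true → ⊥

module _ (G : BidirectedGraph) where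
  open BidirectedGraph G

  V E : Set
  V = Fin nV
  E = Fin nE

  IsSignOf : Sign → V → E → Set
  IsSignOf γ v e = σ γ e v ≡ true

  Joins : E → V → V → Set
  Joins e x y = (end₁ e ≡ x × end₂ e ≡ y) ⊎ (end₁ e ≡ y × end₂ e ≡ x)

  -- A walk (s₁, e₁, s₂, …, e_r, s_{r+1}) is encoded by its first vertex s₁
  -- and the list of steps ((e₁,s₂), …, (e_r,s_{r+1})).
  Steps : Set
  Steps = List (E × V)

  edgesOf : Steps → List E
  edgesOf = map proj₁

  data Walk : V → Steps → V → Set where
    w-nil  : ∀ {s} → Walk s [] s
    w-cons : ∀ {s u t e ws} → Joins e s u → Walk u ws t → Walk s ((e , u) ∷ ws) t

  data DiWalk : V → Sign → Steps → V → Sign → Set where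
    dw-one  : ∀ {s t e α β} → Joins e s t → IsSignOf α s e → IsSignOf β t e →
              DiWalk s α ((e , t) ∷ []) t β
    dw-cons : ∀ {s u t e α γ β ws} → Joins e s u → IsSignOf α s e → IsSignOf γ u e →
              DiWalk u (neg γ) ws t β → DiWalk s α ((e , u) ∷ ws) t β

  Ditrail : Sign → Sign → V → V → Set
  Ditrail α β s t =
    (s ≡ t × α ≢ β) ⊎
    Σ Steps (λ ws → DiWalk s α ws t β × Unique (edgesOf ws))

  Circular : E → Set
  Circular e = Σ V (λ v → Σ Sign (λ γ → Σ Steps (λ ws →
    DiWalk v γ ws v (neg γ) × Unique (edgesOf ws) × e ∈ edgesOf ws)))

  CircularlyConnectedVertices : V → V → Set
  CircularlyConnectedVertices u v = Σ Steps (λ ws →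
    Walk u ws v × Unique (u ∷ map proj₂ ws) × All (λ st → Circular (proj₁ st)) ws)

  CircularlyConnected : Set
  CircularlyConnected = ∀ u v → CircularlyConnectedVertices u v

-- Walk from s along the circular path to t, maintaining an (α,·)-ditrail P from s to the current
-- vertex u.  The next edge uv lies on a cyclic ditrail C, and C contains both u and v.  Let x be the
-- first vertex of P lying on C.  A cyclic ditrail can be entered at any of its vertices with either
-- sign and followed (forwards or backwards, after rotating it to start at x) up to any other of its
-- vertices, so the prefix of P up to x followed by a piece of C is an (α,·)-ditrail from s to v.
-- Its edges are distinct because the prefix avoids the vertices of C before x, hence the edges of C.
module Submission where

open import Defs
open import Data.Product using (Σ; _×_; _,_; proj₁; proj₂)
open import Data.Sum using (_⊎_; inj₁; inj₂)
open import Data.Empty using (⊥-elim)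
open import Data.Fin using (_≟_)
open import Data.List using (List; []; _∷_; map; _++_)
open import Data.List.Properties using (map-++)
open import Data.List.Relation.Unary.All using (All; []; _∷_)
open import Data.List.Relation.Unary.All.Properties using (¬Any⇒All¬; ++⁻ˡ)
open import Data.List.Relation.Unary.AllPairs using ([]; _∷_)
open import Data.List.Relation.Unary.Any using (here; there)
open import Data.List.Relation.Unary.Unique.Propositional using (Unique)
open import Data.List.Relation.Unary.Unique.Propositional.Properties using (Unique[x∷xs]⇒x∉xs)
open import Data.List.Membership.Propositional using (_∈_; _∉_)
open import Data.List.Membership.Propositional.Properties using (∈-++⁺ˡ; ∈-++⁺ʳ; ∈-++⁻)
open import Data.List.Relation.Binary.Subset.Propositional using (_⊆_)
open import Data.List.Relation.Binary.Permutation.Propositional using (_↭_; ↭-refl; ↭-sym; ↭⇒↭ₛ; module PermutationReasoning)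
open import Data.List.Relation.Binary.Permutation.Propositional.Properties
  using (∈-resp-↭; ++-comm; ++⁺ʳ; map⁺)
import Data.List.Relation.Binary.Permutation.Setoid.Properties as PermutationSetoid
open import Relation.Binary.PropositionalEquality using (_≡_; _≢_; refl; sym; trans; cong; subst; setoid)
open import Relation.Nullary using (yes; no)

neg-involutive : ∀ γ → neg (neg γ) ≡ γ
neg-involutive ⊕ = refl
neg-involutive ⊖ = refl

neg-injective : ∀ {γ δ} → neg γ ≡ neg δ → γ ≡ δ
neg-injective {⊕} {⊕} refl = refl
neg-injective {⊖} {⊖} refl = refl

γ≢neg[γ] : ∀ γ → γ ≢ neg γ
γ≢neg[γ] ⊕ ()
γ≢neg[γ] ⊖ ()

sign-dichotomy : ∀ δ γ → δ ≡ γ ⊎ δ ≡ neg γ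
sign-dichotomy ⊕ ⊕ = inj₁ refl
sign-dichotomy ⊕ ⊖ = inj₂ refl
sign-dichotomy ⊖ ⊕ = inj₂ refl
sign-dichotomy ⊖ ⊖ = inj₁ refl

module _ {A : Set} where

  Unique-resp-↭ : {xs ys : List A} → xs ↭ ys → Unique xs → Unique ys
  Unique-resp-↭ p = PermutationSetoid.Unique-resp-↭ (setoid A) (↭⇒↭ₛ p)

  Unique-++⁻ˡ : ∀ (xs : List A) {ys} → Unique (xs ++ ys) → Unique xs
  Unique-++⁻ˡ []       _        = []
  Unique-++⁻ˡ (x ∷ xs) (x∉ ∷ u) = ++⁻ˡ xs x∉ ∷ Unique-++⁻ˡ xs u

  Unique-++⁻ʳ : ∀ (xs : List A) {ys} → Unique (xs ++ ys) → Unique ys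
  Unique-++⁻ʳ []       u       = u
  Unique-++⁻ʳ (x ∷ xs) (_ ∷ u) = Unique-++⁻ʳ xs u

  Unique-∷ : ∀ {x : A} {xs} → x ∉ xs → Unique xs → Unique (x ∷ xs)
  Unique-∷ {xs = xs} x∉xs u = ¬Any⇒All¬ xs x∉xs ∷ u

module Ditrails (G : BidirectedGraph) where
  open import Data.List.Membership.DecPropositional (_≟_ {n = BidirectedGraph.nV G}) using (_∈?_)

  verticesOf : V G → Steps G → List (V G)
  verticesOf s ws = s ∷ map proj₂ ws

  joins-sym : ∀ {e x y} → Joins G e x y → Joins G e y x
  joins-sym (inj₁ ends) = inj₂ ends
  joins-sym (inj₂ ends) = inj₁ ends

  joins-ends : ∀ {e x y s u} → Joins G e x y → Joins G e s u → x ≡ s ⊎ x ≡ u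
  joins-ends (inj₁ (refl , _)) (inj₁ (p , _)) = inj₁ p
  joins-ends (inj₁ (refl , _)) (inj₂ (p , _)) = inj₂ p
  joins-ends (inj₂ (_ , refl)) (inj₁ (_ , p)) = inj₂ p
  joins-ends (inj₂ (_ , refl)) (inj₂ (_ , p)) = inj₁ p

  -- DiWalk extended by the empty walk, which is an (α,β)-diwalk exactly when α ≠ β, as for the
  -- one-term ditrail.  With this convention diwalks can be split at and glued along any vertex.
  data DiWalk⁰ : V G → Sign → Steps G → V G → Sign → Set where
    nil  : ∀ {s α β} → α ≡ neg β → DiWalk⁰ s α [] s β
    cons : ∀ {s u t e α γ β ws} → Joins G e s u → IsSignOf G α s e → IsSignOf G γ u e →
           DiWalk⁰ u (neg γ) ws t β → DiWalk⁰ s α ((e , u) ∷ ws) t β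

  fromDiWalk : ∀ {s α ws t β} → DiWalk G s α ws t β → DiWalk⁰ s α ws t β
  fromDiWalk (dw-one j sα sβ)      = cons j sα sβ (nil refl)
  fromDiWalk (dw-cons j sα sγ dws) = cons j sα sγ (fromDiWalk dws)

  toDiWalk : ∀ {s α st ws t β} → DiWalk⁰ s α (st ∷ ws) t β → DiWalk G s α (st ∷ ws) t β
  toDiWalk (cons j sα sγ (nil γ≡β)) =
    dw-one j sα (subst (λ δ → IsSignOf G δ _ _) (neg-injective γ≡β) sγ)
  toDiWalk (cons j sα sγ dws@(cons _ _ _ _)) = dw-cons j sα sγ (toDiWalk dws)

  infixr 5 _++ᵈ_
  _++ᵈ_ : ∀ {s α p u γ q t β} → DiWalk⁰ s α p u γ → DiWalk⁰ u (neg γ) q t β → DiWalk⁰ s α (p ++ q) t β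
  nil α≡ ++ᵈ d = subst (λ δ → DiWalk⁰ _ δ _ _ _) (sym α≡) d
  cons j sα sγ d₁ ++ᵈ d₂ = cons j sα sγ (d₁ ++ᵈ d₂)

  splitAt : ∀ {s α ws t β y} → DiWalk⁰ s α ws t β → y ∈ verticesOf s ws →
            Σ (Steps G) λ p → Σ (Steps G) λ q → Σ Sign λ γ →
            ws ≡ p ++ q × DiWalk⁰ s α p y γ × DiWalk⁰ y (neg γ) q t β
  splitAt {α = α} d (here refl) =
    [] , _ , neg α , refl , nil (sym (neg-involutive α)) ,
    subst (λ δ → DiWalk⁰ _ δ _ _ _) (sym (neg-involutive α)) d
  splitAt (nil _) (there ())
  splitAt (cons {u = u} {e = e} j sα sγ d) (there y∈) with splitAt d y∈
  ... | p , q , γ , refl , d₁ , d₂ = (e , u) ∷ p , q , γ , refl , cons j sα sγ d₁ , d₂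

  reverseSteps : V G → Steps G → Steps G
  reverseSteps s []             = []
  reverseSteps s ((e , u) ∷ ws) = reverseSteps u ws ++ (e , s) ∷ []

  reverse : ∀ {s α ws t β} → DiWalk⁰ s α ws t β → DiWalk⁰ t β (reverseSteps s ws) s α
  reverse (nil {β = β} α≡) = nil (trans (sym (neg-involutive β)) (cong neg (sym α≡)))
  reverse (cons {γ = γ} j sα sγ d) =
    reverse d ++ᵈ subst (λ δ → DiWalk⁰ _ δ _ _ _) (sym (neg-involutive γ))
                        (cons (joins-sym j) sγ sα (nil refl))

  edgesOf-reverseSteps : ∀ s ws → edgesOf G (reverseSteps s ws) ↭ edgesOf G ws
  edgesOf-reverseSteps s [] = ↭-refl
  edgesOf-reverseSteps s ((e , u) ∷ ws) = begin
    edgesOf G (reverseSteps u ws ++ (e , s) ∷ []) ≡⟨ map-++ proj₁ (reverseSteps u ws) _ ⟩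
    edgesOf G (reverseSteps u ws) ++ e ∷ []       ↭⟨ ++⁺ʳ (e ∷ []) (edgesOf-reverseSteps u ws) ⟩
    edgesOf G ws ++ e ∷ []                        ↭⟨ ++-comm (edgesOf G ws) (e ∷ []) ⟩
    e ∷ edgesOf G ws                              ∎
    where open PermutationReasoning

  last∈ : ∀ {s α st ws t β} → DiWalk⁰ s α (st ∷ ws) t β → t ∈ map proj₂ (st ∷ ws)
  last∈ (cons _ _ _ (nil _))          = here refl
  last∈ (cons _ _ _ d@(cons _ _ _ _)) = there (last∈ d)

  endpoint∈ : ∀ {s α ws t β e x y} → DiWalk⁰ s α ws t β → e ∈ edgesOf G ws →
              Joins G e x y → x ∈ verticesOf s ws
  endpoint∈ (cons j _ _ _) (here refl) jx with joins-ends jx j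
  ... | inj₁ x≡s = here x≡s
  ... | inj₂ x≡u = there (here x≡u)
  endpoint∈ (cons _ _ _ d) (there e∈) jx = there (endpoint∈ d e∈ jx)

  endpoint∈closed : ∀ {v α ws β e x y} → DiWalk⁰ v α ws v β → e ∈ edgesOf G ws →
                    Joins G e x y → x ∈ map proj₂ ws
  endpoint∈closed {ws = _ ∷ _} d e∈ jx with endpoint∈ d e∈ jx
  ... | here refl = last∈ d
  ... | there x∈  = x∈

  record Ditrail⁰ (s : V G) (α : Sign) (t : V G) (β : Sign) : Set where
    constructor ditrail
    field
      steps    : Steps G
      diwalk   : DiWalk⁰ s α steps t β
      distinct : Unique (edgesOf G steps)

  open Ditrail⁰

  edges : ∀ {s α t β} → Ditrail⁰ s α t β → List (E G)
  edges T = edgesOf G (steps T)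

  toDitrail : ∀ {s α t β} → Ditrail⁰ s α t β → Ditrail G α β s t
  toDitrail (ditrail [] (nil {β = β} α≡) _) = inj₁ (refl , λ α≡β → γ≢neg[γ] β (trans (sym α≡β) α≡))
  toDitrail (ditrail (_ ∷ _) d u)           = inj₂ (_ , toDiWalk d , u)

  DitrailWithin : List (E G) → V G → Sign → V G → Set
  DitrailWithin S s α t = Σ Sign λ β → Σ (Ditrail⁰ s α t β) λ T → edges T ⊆ S

  splitDitrail : ∀ {s α t β y} (T : Ditrail⁰ s α t β) → y ∈ verticesOf s (steps T) →
                 Σ Sign λ γ → Σ (Ditrail⁰ s α y γ) λ P → Σ (Ditrail⁰ y (neg γ) t β) λ Q →
                 edges P ⊆ edges T × edges Q ⊆ edges T
  splitDitrail (ditrail _ d u) y∈ with splitAt d y∈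
  ... | p , q , γ , refl , d₁ , d₂ =
    γ , ditrail p d₁ (Unique-++⁻ˡ (edgesOf G p) u′) , ditrail q d₂ (Unique-++⁻ʳ (edgesOf G p) u′) ,
    (λ e∈ → subst (_ ∈_) (sym edges≡) (∈-++⁺ˡ e∈)) ,
    (λ e∈ → subst (_ ∈_) (sym edges≡) (∈-++⁺ʳ (edgesOf G p) e∈))
    where
    edges≡ : edgesOf G (p ++ q) ≡ edgesOf G p ++ edgesOf G q
    edges≡ = map-++ proj₁ p q
    u′ : Unique (edgesOf G p ++ edgesOf G q)
    u′ = subst Unique edges≡ u

  reverseDitrail : ∀ {s α t β} (T : Ditrail⁰ s α t β) →
                   Σ (Ditrail⁰ t β s α) λ R → edges R ⊆ edges T
  reverseDitrail {s = s} (ditrail ws d u) =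
    ditrail (reverseSteps s ws) (reverse d) (Unique-resp-↭ (↭-sym rev↭) u) , ∈-resp-↭ rev↭
    where
    rev↭ : edgesOf G (reverseSteps s ws) ↭ edgesOf G ws
    rev↭ = edgesOf-reverseSteps s ws

  rotate : ∀ {v γ x} (C : Ditrail⁰ v γ v (neg γ)) → x ∈ map proj₂ (steps C) →
           Σ Sign λ β → Σ (Ditrail⁰ x (neg β) x β) λ R → steps R ↭ steps C
  rotate {γ = γ} (ditrail _ d u) x∈ with splitAt d (there x∈)
  ... | p , q , β , refl , d₁ , d₂ =
    β , ditrail (q ++ p) (d₂ ++ᵈ subst (λ δ → DiWalk⁰ _ δ _ _ _) (sym (neg-involutive γ)) d₁)
                         (Unique-resp-↭ (map⁺ proj₁ p++q↭) u) ,
    ↭-sym p++q↭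
    where
    p++q↭ : p ++ q ↭ q ++ p
    p++q↭ = ++-comm p q

  DitrailWithin-mono : ∀ {S S′ s α t} → S ⊆ S′ → DitrailWithin S s α t → DitrailWithin S′ s α t
  DitrailWithin-mono S⊆S′ (β , T , T⊆S) = β , T , λ e∈ → S⊆S′ (T⊆S e∈)

  -- After rotating the cycle to start at x, the two arcs from x to w leave x with opposite signs:
  -- the forward one directly, the backward one as the reversal of the arc from w back to x.
  connectWithinCycle : ∀ {v γ x w} (C : Ditrail⁰ v γ v (neg γ)) →
                       x ∈ map proj₂ (steps C) → w ∈ map proj₂ (steps C) →
                       ∀ δ → DitrailWithin (edges C) x δ w
  connectWithinCycle {w = w} C x∈ w∈ δ with rotate C x∈
  ... | β , R , R↭C = arcs (sign-dichotomy δ β)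
    where
    R⊆C : edges R ⊆ edges C
    R⊆C = ∈-resp-↭ (map⁺ proj₁ R↭C)

    w∈R : w ∈ verticesOf _ (steps R)
    w∈R = there (∈-resp-↭ (map⁺ proj₂ (↭-sym R↭C)) w∈)

    arcs : δ ≡ β ⊎ δ ≡ neg β → DitrailWithin (edges C) _ δ w
    arcs (inj₂ refl) =
      let γ , P , _ , P⊆R , _ = splitDitrail R w∈R
      in γ , P , λ e∈ → R⊆C (P⊆R e∈)
    arcs (inj₁ refl) =
      let γ , _ , Q , _ , Q⊆R = splitDitrail R w∈R
          Q⁻¹ , Q⁻¹⊆Q = reverseDitrail Q
      in neg γ , Q⁻¹ , λ e∈ → R⊆C (Q⊆R (Q⁻¹⊆Q e∈))

  extendThroughCycle : ∀ {v γ s δ u β w} (C : Ditrail⁰ v γ v (neg γ)) → w ∈ map proj₂ (steps C) →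
                       (P : Ditrail⁰ s δ u β) → u ∈ map proj₂ (steps C) →
                       DitrailWithin (edges P ++ edges C) s δ w
  extendThroughCycle {s = s} C w∈ P u∈ with s ∈? map proj₂ (steps C)
  ... | yes s∈ = DitrailWithin-mono (∈-++⁺ʳ (edges P)) (connectWithinCycle C s∈ w∈ _)
  extendThroughCycle C w∈ (ditrail _ (nil _) _) u∈ | no s∉ = ⊥-elim (s∉ u∈)
  extendThroughCycle C w∈ (ditrail ((e , u′) ∷ ws) (cons j sδ sγ d) (e≢ws ∷ uws)) u∈ | no s∉
    with extendThroughCycle C w∈ (ditrail ws d uws) u∈
  ... | β′ , ditrail qs d′ uqs , qs⊆ =
    β′ , ditrail ((e , u′) ∷ qs) (cons j sδ sγ d′) (Unique-∷ (λ e∈ → e∉ (qs⊆ e∈)) uqs) , e∷qs⊆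
    where
    e∉ : e ∉ edgesOf G ws ++ edges C
    e∉ e∈ with ∈-++⁻ (edgesOf G ws) e∈
    ... | inj₁ e∈ws = Unique[x∷xs]⇒x∉xs (e≢ws ∷ uws) e∈ws
    ... | inj₂ e∈C  = s∉ (endpoint∈closed (diwalk C) e∈C j)

    e∷qs⊆ : e ∷ edgesOf G qs ⊆ e ∷ edgesOf G ws ++ edges C
    e∷qs⊆ (here e≡)  = here e≡
    e∷qs⊆ (there e∈) = there (qs⊆ e∈)

  Reachable : Sign → V G → V G → Set
  Reachable α s t = Σ Sign (Ditrail⁰ s α t)

  reachableFromItself : ∀ α s → Reachable α s s
  reachableFromItself α s = neg α , ditrail [] (nil (sym (neg-involutive α))) []

  reachableAcrossCircular : ∀ {α s u t e} → Reachable α s u → Joins G e u t → Circular G e →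
                            Reachable α s t
  reachableAcrossCircular (_ , P) j (v , γ , cs , dC , uC , e∈) =
    let β , T , _ = extendThroughCycle C (endpoint∈closed dC⁰ e∈ (joins-sym j)) P
                                         (endpoint∈closed dC⁰ e∈ j)
    in β , T
    where
    dC⁰ : DiWalk⁰ v γ cs v (neg γ)
    dC⁰ = fromDiWalk dC

    C : Ditrail⁰ v γ v (neg γ)
    C = ditrail cs dC⁰ uC

  reachableAlong : ∀ {α s u ws t} → Reachable α s u → Walk G u ws t →
                   All (λ st → Circular G (proj₁ st)) ws → Reachable α s t
  reachableAlong r w-nil           []       = r
  reachableAlong r (w-cons j walk) (c ∷ cs) = reachableAlong (reachableAcrossCircular r j c) walk cs

proposition5p2 : (G : BidirectedGraph) → CircularlyConnected G →
    (α : Sign) (s : V G) → (t : V G) → Σ Sign (λ β → Ditrail G α β s t)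
proposition5p2 G connected α s t =
  let _ , walk , _ , circular = connected s t
      β , T = reachableAlong (reachableFromItself α s) walk circular
  in β , toDitrail T
  where open Ditrails G
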